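{- Let $N$ be a positive integer. The maps $s_N$ and $f_N$ form an exact sequence of $\mathbb{F}_2[\Omega_N]$-modules $$0\to\mathbb{F}_2^{L_{N-1}}\xrightarrow{s_N}\mathbb{F}_2^{L_N}\xrightarrow{f_N}\mathbb{F}_2^{L_{N-1}}\to0,$$ and $s_N(\mathbb{F}_2^{L_{N-1}})=I_{\Omega_N}^{2^{N-1}}\cdot\mathbb{F}_2^{L_N}$.
   Context: $T_\infty$: Cayley graph of the free monoid on $\{x,y\}$ (word $w$ joined to $xw,yw$), $L_N$ = words of length $N$, $\Omega_N$ = group of automorphisms of the rooted binary tree $\bigcup_{i\le N}L_i$ (the image of $\mathrm{Aut}(T_\infty)$). $\mathbb{F}_2^{L_N}$ is the $\mathbb{F}_2$-vector space with basis $L_N$, an $\mathbb{F}_2[\Omega_N]$-module by permutation; $\mathbb{F}_2^{L_{N-1}}$ is an $\mathbb{F}_2[\Omega_N]$-module via $\Omega_N\twoheadrightarrow\Omega_{N-1}$. $s_N$ is the linear map sending a basis vector $w\in L_{N-1}$ to $xw+yw$ (sum of its two neighbours in $L_N$); $f_N$ is the linear map sending a basis vector $v\in L_N$ to its neighbour in $L_{N-1}$ (delete the first letter). $I_{\Omega_N}$ is the augmentation ideal of $\mathbb{F}_2[\Omega_N]$. -}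

module Defs where

open import Data.Nat using (ℕ; zero; suc; _≤_)
open import Data.Nat.Properties using (≤-refl; ≤-trans; n≤1+n)
open import Data.Bool using (Bool; true; false; _xor_)
open import Data.Vec using (Vec; []; _∷_; tail)
open import Relation.Binary.PropositionalEquality using (_≡_)

-- Words of length k over {x, y}; x is encoded as false, y as true.
-- The word a ∷ w is the letter a prepended to w; its neighbour one level
-- down is w (delete the first letter).  L_k = Word k.
Word : ℕ → Set
Word k = Vec Bool k

𝕩 𝕪 : Bool
𝕩 = false
𝕪 = true

-- Ω_N : automorphisms of the rooted binary tree ⋃_{k ≤ N} L_k.
-- A root-preserving graph automorphism preserves levels, so it is a family
-- of bijections σ_k of L_k (k ≤ N) compatible with the edges, i.e. with the
-- map "delete the first letter".
record Aut (N : ℕ) : Set where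
  field
    σ     : ∀ {k} → .(k ≤ N) → Word k → Word k
    σ⁻¹   : ∀ {k} → .(k ≤ N) → Word k → Word k
    σ⁻¹σ  : ∀ {k} .(p : k ≤ N) (w : Word k) → σ⁻¹ p (σ p w) ≡ w
    σσ⁻¹  : ∀ {k} .(p : k ≤ N) (w : Word k) → σ p (σ⁻¹ p w) ≡ w
    σ-edge : ∀ {k} .(p : suc k ≤ N) (a : Bool) (w : Word k) →
             tail (σ p (a ∷ w)) ≡ σ (≤-trans (n≤1+n k) p) w
open Aut public

V : ℕ → Set
V k = Word k → Bool

0V : ∀ {k} → V k
0V _ = false

_⊕_ : ∀ {k} → V k → V k → V k
(u ⊕ v) w = u w xor v w
infixl 6 _⊕_

act : ∀ {N k} → Aut N → .(k ≤ N) → V k → V k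
act g p v w = v (σ⁻¹ g p w)

-- The module 𝔽₂^{L_N} (N = suc n) and 𝔽₂^{L_{N-1}} (via Ω_N ↠ Ω_{N-1}).
_·top_ : ∀ {n} → Aut (suc n) → V (suc n) → V (suc n)
g ·top v = act g ≤-refl v

_·low_ : ∀ {n} → Aut (suc n) → V n → V n
_·low_ {n} g v = act g (n≤1+n n) v

-- s_N : basis vector w ↦ xw + yw
s : ∀ {n} → V n → V (suc n)
s v (a ∷ w) = v w

-- f_N : basis vector v ↦ its neighbour in L_{N-1} (delete first letter)
f : ∀ {n} → V (suc n) → V n
f u w = u (𝕩 ∷ w) xor u (𝕪 ∷ w)

-- I_Ω^k · M for M = 𝔽₂^{L_N}, defined by I^0 M = M and
-- I^{k+1} M = I·(I^k M) = 𝔽₂-span of { (g - 1)·u : g ∈ Ω_N, u ∈ I^k M }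
-- (over 𝔽₂, g - 1 = g + 1).  Closed under pointwise equality (no funext).
data AugPow (N : ℕ) : ℕ → V N → Set where
  base : ∀ v → AugPow N zero v
  zro  : ∀ {k} → AugPow N (suc k) 0V
  add  : ∀ {k u v} → AugPow N (suc k) u → AugPow N (suc k) v →
         AugPow N (suc k) (u ⊕ v)
  gen  : ∀ {k u} (g : Aut N) → AugPow N k u →
         AugPow N (suc k) (act g ≤-refl u ⊕ u)
  resp : ∀ {k u v} → (∀ w → u w ≡ v w) → AugPow N k u → AugPow N k v

{-# OPTIONS --safe #-}
-- The exactness statements are checked on the two children x w, y w of each
-- word w; equivariance holds because an automorphism permutes the children of
-- w onto the children of its image.
--
-- I^{2^k} annihilates 𝔽₂^{L_k}, by induction on k: f carries
-- I^{2^k} 𝔽₂^{L_{k+1}} into I^{2^k} 𝔽₂^{L_k} = 0, so it lies in the image of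
-- s, a copy of 𝔽₂^{L_k} on which a further I^{2^k} acts as zero.  Hence f kills
-- I^{2^{N-1}} 𝔽₂^{L_N}, which therefore lies in the image of s.  Conversely,
-- for the odometer g (adding one in binary) we have
-- (g - 1)^{2^{N-1}} = g^{2^{N-1}} - 1 in characteristic 2, and g^{2^{N-1}}
-- flips the first letter; applied to the vector equal to v on the words
-- starting with y and 0 elsewhere it yields s v.
module Submission where

open import Defs
open import Algebra.Bundles using (CommutativeRing)
open import Data.Bool using (Bool; true; false; not; _∧_; _xor_)
open import Data.Bool.Properties
  using (xor-∧-commutativeRing; xor-assoc; xor-comm; xor-same; xor-identityʳ; ∧-zeroʳ; ¬-not)
open import Data.Nat using (ℕ; zero; suc; _^_; _+_; _*_; _≤_)
open import Data.Nat.GeneralisedArithmetic using (fold; fold-+; fold-*)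
open import Data.Nat.Properties
  using (≤-refl; n≤1+n; <⇒≤; +-identityʳ; *-comm; +-commutativeSemigroup)
open import Data.Product using (_×_; ∃; _,_; proj₁; proj₂)
open import Data.Vec using ([]; _∷_; tail; _∷ʳ_; initLast)
open import Function.Base using (_∘_; id)
open import Function.Bundles using (_⇔_; mk⇔)
open import Relation.Binary.PropositionalEquality
  using (_≡_; _≢_; _≗_; refl; sym; trans; cong; cong₂; subst; module ≡-Reasoning)
open import Relation.Unary using (U)
open import Algebra.Properties.CommutativeSemigroup
  (CommutativeRing.+-commutativeSemigroup xor-∧-commutativeRing) using (interchange)
open import Algebra.Properties.CommutativeSemigroup +-commutativeSemigroup
  using () renaming (xy∙z≈xz∙y to +-right-comm)

open ≡-Reasoning

private
  variable
    N k : ℕ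

xor-cancelʳ : ∀ a b → (a xor b) xor b ≡ a
xor-cancelʳ a b = begin
  (a xor b) xor b ≡⟨ xor-assoc a b b ⟩
  a xor (b xor b) ≡⟨ cong (a xor_) (xor-same b) ⟩
  a xor false     ≡⟨ xor-identityʳ a ⟩
  a               ∎

xor-cancel-middle : ∀ a b c → (a xor b) xor (b xor c) ≡ a xor c
xor-cancel-middle a b c =
  trans (sym (xor-assoc (a xor b) b c)) (cong (_xor c) (xor-cancelʳ a b))

xor≡false⇒≡ : ∀ {a b} → a xor b ≡ false → a ≡ b
xor≡false⇒≡ {a} {b} e = trans (sym (xor-cancelʳ a b)) (cong (_xor b) e)

σ⁻¹-injective : ∀ (g : Aut N) .(p : k ≤ N) {w w′} → σ⁻¹ g p w ≡ σ⁻¹ g p w′ → w ≡ w′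
σ⁻¹-injective g p {w} {w′} e = trans (sym (σσ⁻¹ g p w)) (trans (cong (σ g p) e) (σσ⁻¹ g p w′))

σ-tail : ∀ (g : Aut N) .(p : suc k ≤ N) (z : Word (suc k)) → tail (σ g p z) ≡ σ g (<⇒≤ p) (tail z)
σ-tail g p (a ∷ w) = σ-edge g p a w

σ⁻¹-edge : ∀ (g : Aut N) .(p : suc k ≤ N) a (w : Word k) →
           tail (σ⁻¹ g p (a ∷ w)) ≡ σ⁻¹ g (<⇒≤ p) w
σ⁻¹-edge g p a w = begin
  tail z                    ≡⟨ sym (σ⁻¹σ g (<⇒≤ p) (tail z)) ⟩
  σ⁻¹′ (σ g (<⇒≤ p) (tail z)) ≡⟨ cong σ⁻¹′ (sym (σ-tail g p z)) ⟩
  σ⁻¹′ (tail (σ g p z))     ≡⟨ cong (σ⁻¹′ ∘ tail) (σσ⁻¹ g p (a ∷ w)) ⟩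
  σ⁻¹′ w                    ∎
  where
  z = σ⁻¹ g p (a ∷ w)
  σ⁻¹′ = σ⁻¹ g (<⇒≤ p)

σ⁻¹-children : ∀ (g : Aut N) .(p : suc k ≤ N) (w : Word k) → ∃ λ b →
               σ⁻¹ g p (𝕩 ∷ w) ≡ b ∷ σ⁻¹ g (<⇒≤ p) w ×
               σ⁻¹ g p (𝕪 ∷ w) ≡ not b ∷ σ⁻¹ g (<⇒≤ p) w
σ⁻¹-children g p w with σ⁻¹ g p (𝕩 ∷ w) in eqˣ | σ⁻¹ g p (𝕪 ∷ w) in eqʸ
... | b ∷ zˣ | c ∷ zʸ = b , cong (b ∷_) zˣ≡ , cong₂ _∷_ c≡not-b zʸ≡
  where
  zˣ≡ : zˣ ≡ σ⁻¹ g (<⇒≤ p) w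
  zˣ≡ = trans (cong tail (sym eqˣ)) (σ⁻¹-edge g p 𝕩 w)
  zʸ≡ : zʸ ≡ σ⁻¹ g (<⇒≤ p) w
  zʸ≡ = trans (cong tail (sym eqʸ)) (σ⁻¹-edge g p 𝕪 w)
  c≡not-b : c ≡ not b
  c≡not-b = ¬-not λ c≡b → x≢y (σ⁻¹-injective g p
    (trans eqˣ (trans (cong₂ _∷_ (sym c≡b) (trans zˣ≡ (sym zʸ≡))) (sym eqʸ))))
    where
    x≢y : 𝕩 ∷ w ≢ 𝕪 ∷ w
    x≢y ()

s-⊕ : (u v : V k) → s (u ⊕ v) ≗ s u ⊕ s v
s-⊕ u v (a ∷ w) = refl

f-⊕ : (u v : V (suc k)) → f (u ⊕ v) ≗ f u ⊕ f v
f-⊕ u v w = interchange (u (𝕩 ∷ w)) (v (𝕩 ∷ w)) (u (𝕪 ∷ w)) (v (𝕪 ∷ w))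

s-act : ∀ (g : Aut N) .(p : suc k ≤ N) (v : V k) → s (act g (<⇒≤ p) v) ≗ act g p (s v)
s-act g p v (a ∷ w) with σ⁻¹-children g p w
s-act g p v (false ∷ w) | _ , eqˣ , _ = sym (cong (s v) eqˣ)
s-act g p v (true ∷ w)  | _ , _ , eqʸ = sym (cong (s v) eqʸ)

f-act : ∀ (g : Aut N) .(p : suc k ≤ N) (u : V (suc k)) → f (act g p u) ≗ act g (<⇒≤ p) (f u)
f-act g p u w with σ⁻¹-children g p w
... | false , eqˣ , eqʸ = cong₂ _xor_ (cong u eqˣ) (cong u eqʸ)
... | true  , eqˣ , eqʸ = trans (cong₂ _xor_ (cong u eqˣ) (cong u eqʸ))
                                (xor-comm (u (𝕪 ∷ σ⁻¹ g (<⇒≤ p) w)) _)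

s-injective : (v : V k) → s v ≗ 0V → v ≗ 0V
s-injective v e w = e (𝕩 ∷ w)

f∘s≗0 : (v : V k) → f (s v) ≗ 0V
f∘s≗0 v w = xor-same (v w)

Im-s : V (suc k) → Set
Im-s u = ∃ λ v → s v ≗ u

ker-f⊆Im-s : (u : V (suc k)) → f u ≗ 0V → Im-s u
ker-f⊆Im-s u e = (λ w → u (𝕩 ∷ w)) , λ where
  (false ∷ w) → refl
  (true ∷ w)  → xor≡false⇒≡ (e w)

yBranch : V k → V (suc k)
yBranch v (false ∷ w) = false
yBranch v (true ∷ w)  = v w

f-yBranch : (v : V k) → f (yBranch v) ≗ v
f-yBranch v w = refl

-- AugPowOf p Q m is I_{Ω_N}^m · span Q inside 𝔽₂^{L_k}, for any level k ≤ N;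
-- AugPow N m is the case k = N, Q = everything.
data AugPowOf .(p : k ≤ N) (Q : V k → Set) : ℕ → V k → Set where
  base : ∀ {v} → Q v → AugPowOf p Q 0 v
  zro  : ∀ {m} → AugPowOf p Q (suc m) 0V
  add  : ∀ {m u v} → AugPowOf p Q (suc m) u → AugPowOf p Q (suc m) v →
         AugPowOf p Q (suc m) (u ⊕ v)
  gen  : ∀ {m u} (g : Aut N) → AugPowOf p Q m u → AugPowOf p Q (suc m) (act g p u ⊕ u)
  resp : ∀ {m u v} → u ≗ v → AugPowOf p Q m u → AugPowOf p Q m v

AugPow⇒AugPowOf : ∀ {m u} → AugPow N m u → AugPowOf ≤-refl U m u
AugPow⇒AugPowOf (base v)   = base _
AugPow⇒AugPowOf zro        = zro
AugPow⇒AugPowOf (add d e)  = add (AugPow⇒AugPowOf d) (AugPow⇒AugPowOf e)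
AugPow⇒AugPowOf (gen g d)  = gen g (AugPow⇒AugPowOf d)
AugPow⇒AugPowOf (resp e d) = resp e (AugPow⇒AugPowOf d)

AugPowOf-split : ∀ .{p : k ≤ N} {Q} a b {u} →
                 AugPowOf p Q (a + b) u → AugPowOf p (AugPowOf p Q b) a u
AugPowOf-split zero    b d          = base d
AugPowOf-split (suc a) b zro        = zro
AugPowOf-split (suc a) b (add d e)  =
  add (AugPowOf-split (suc a) b d) (AugPowOf-split (suc a) b e)
AugPowOf-split (suc a) b (gen g d)  = gen g (AugPowOf-split a b d)
AugPowOf-split (suc a) b (resp e d) = resp e (AugPowOf-split (suc a) b d)

AugPowOf-level0 : ∀ .{p : 0 ≤ N} {Q m u} → AugPowOf p Q (suc m) u → u ≗ 0V
AugPowOf-level0 zro [] = refl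
AugPowOf-level0 (add d e) [] = cong₂ _xor_ (AugPowOf-level0 d []) (AugPowOf-level0 e [])
AugPowOf-level0 {p = p} (gen {u = u} g d) [] with σ⁻¹ g p []
... | [] = xor-same (u [])
AugPowOf-level0 (resp e d) [] = trans (sym (e [])) (AugPowOf-level0 d [])

module _ .{p : suc k ≤ N} where

  f-AugPowOf : ∀ {m u} → AugPowOf p U m u → AugPowOf (<⇒≤ p) U m (f u)
  f-AugPowOf (base _) = base _
  f-AugPowOf zro = zro
  f-AugPowOf (add {u = u} {v} d e) =
    resp (λ w → sym (f-⊕ u v w)) (add (f-AugPowOf d) (f-AugPowOf e))
  f-AugPowOf (gen {u = u} g d) = resp equivariant (gen g (f-AugPowOf d))
    where
    equivariant : act g (<⇒≤ p) (f u) ⊕ f u ≗ f (act g p u ⊕ u)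
    equivariant w = sym (trans (f-⊕ (act g p u) u w) (cong (_xor f u w) (f-act g p u w)))
  f-AugPowOf (resp e d) = resp (λ w → cong₂ _xor_ (e _) (e _)) (f-AugPowOf d)

  AugPowOf-Im-s : ∀ {Q} → (∀ {u} → Q u → Im-s u) →
                  ∀ {a u} → AugPowOf p Q a u → ∃ λ v → s v ≗ u × AugPowOf (<⇒≤ p) U a v
  AugPowOf-Im-s Q⊆Im-s (base q) = let v , sv≗u = Q⊆Im-s q in v , sv≗u , base _
  AugPowOf-Im-s Q⊆Im-s zro = 0V , (λ where (a ∷ w) → refl) , zro
  AugPowOf-Im-s Q⊆Im-s (add d e) =
    let v₁ , e₁ , d₁ = AugPowOf-Im-s Q⊆Im-s d
        v₂ , e₂ , d₂ = AugPowOf-Im-s Q⊆Im-s e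
    in v₁ ⊕ v₂ , (λ z → trans (s-⊕ v₁ v₂ z) (cong₂ _xor_ (e₁ z) (e₂ z))) , add d₁ d₂
  AugPowOf-Im-s Q⊆Im-s (gen g d) =
    let v , e , dv = AugPowOf-Im-s Q⊆Im-s d
    in act g (<⇒≤ p) v ⊕ v ,
       (λ z → trans (s-⊕ _ v z) (cong₂ _xor_ (trans (s-act g p v z) (e _)) (e z))) ,
       gen g dv
  AugPowOf-Im-s Q⊆Im-s (resp e′ d) =
    let v , e , dv = AugPowOf-Im-s Q⊆Im-s d in v , (λ z → trans (e z) (e′ z)) , dv

AugPowOf-vanishes : ∀ k .(p : k ≤ N) j {u} → AugPowOf p U (2 ^ k + j) u → u ≗ 0V
AugPowOf-vanishes zero    p j d = AugPowOf-level0 d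
AugPowOf-vanishes (suc k) p j {u} d (a ∷ w) =
  trans (sym (sv≗u (a ∷ w))) (AugPowOf-vanishes k (<⇒≤ p) j dv w)
  where
  x = 2 ^ k
  reassoc : (x + (x + 0)) + j ≡ (x + j) + (x + 0)
  reassoc = +-right-comm x (x + 0) j
  inner⊆Im-s : ∀ {u′} → AugPowOf p U (x + 0) u′ → Im-s u′
  inner⊆Im-s {u′} d′ = ker-f⊆Im-s u′ (AugPowOf-vanishes k (<⇒≤ p) 0 (f-AugPowOf d′))
  lifted = AugPowOf-Im-s inner⊆Im-s
             (AugPowOf-split (x + j) (x + 0) (subst (λ m → AugPowOf p U m u) reassoc d))
  sv≗u = proj₁ (proj₂ lifted)
  dv = proj₂ (proj₂ lifted)

-- Over 𝔽₂ the operator g - 1 = g + 1 acts by u ↦ u ∘ h ⊕ u, where h = σ⁻¹ g.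
Δ : (Word k → Word k) → V k → V k
Δ h u = (λ w → u (h w)) ⊕ u

Δ^2^ : (h : Word k → Word k) (j : ℕ) (u : V k) (w : Word k) →
       fold u (Δ h) (2 ^ j) w ≡ u (fold w h (2 ^ j)) xor u w
Δ^2^ h zero    u w = refl
Δ^2^ h (suc j) u w = begin
  fold u (Δ h) (2 ^ suc j) w     ≡⟨ cong (λ i → fold u (Δ h) i w) double ⟩
  fold u (Δ h) (m + m) w         ≡⟨ cong (λ v → v w) (fold-+ u (Δ h) m) ⟩
  fold uₘ (Δ h) m w              ≡⟨ Δ^2^ h j uₘ w ⟩
  uₘ (hᵐ w) xor uₘ w             ≡⟨ cong₂ _xor_ (Δ^2^ h j u (hᵐ w)) (Δ^2^ h j u w) ⟩
  (u (hᵐ (hᵐ w)) xor u (hᵐ w)) xor (u (hᵐ w) xor u w)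
                                 ≡⟨ xor-cancel-middle (u (hᵐ (hᵐ w))) (u (hᵐ w)) (u w) ⟩
  u (hᵐ (hᵐ w)) xor u w          ≡⟨ cong (λ z → u z xor u w) (sym (fold-+ w h m)) ⟩
  u (fold w h (m + m)) xor u w   ≡⟨ cong (λ i → u (fold w h i) xor u w) (sym double) ⟩
  u (fold w h (2 ^ suc j)) xor u w ∎
  where
  m = 2 ^ j
  uₘ = fold u (Δ h) m
  hᵐ = λ z → fold z h m
  double : 2 ^ suc j ≡ m + m
  double = cong (m +_) (+-identityʳ m)

allTrue allFalse : Word k → Bool
allTrue  []      = true
allTrue  (a ∷ w) = a ∧ allTrue w
allFalse []      = true
allFalse (a ∷ w) = not a ∧ allFalse w

-- A word is a binary numeral with its first letter most significant; inc adds
-- one, the carry into the first letter being allTrue of the rest.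
inc dec : Word k → Word k
inc []      = []
inc (a ∷ w) = (a xor allTrue w) ∷ inc w
dec []      = []
dec (a ∷ w) = (a xor allFalse w) ∷ dec w

allFalse-inc : (w : Word k) → allFalse (inc w) ≡ allTrue w
allFalse-inc []      = refl
allFalse-inc (a ∷ w) =
  trans (cong (not (a xor allTrue w) ∧_) (allFalse-inc w)) (carry a (allTrue w))
  where
  carry : ∀ a t → not (a xor t) ∧ t ≡ a ∧ t
  carry false false = refl
  carry false true  = refl
  carry true  false = refl
  carry true  true  = refl

allTrue-dec : (w : Word k) → allTrue (dec w) ≡ allFalse w
allTrue-dec []      = refl
allTrue-dec (a ∷ w) =
  trans (cong ((a xor allFalse w) ∧_) (allTrue-dec w)) (borrow a (allFalse w))
  where
  borrow : ∀ a t → (a xor t) ∧ t ≡ not a ∧ t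
  borrow false false = refl
  borrow false true  = refl
  borrow true  false = refl
  borrow true  true  = refl

dec-inc : (w : Word k) → dec (inc w) ≡ w
dec-inc []      = refl
dec-inc (a ∷ w) =
  cong₂ _∷_ (trans (cong ((a xor allTrue w) xor_) (allFalse-inc w)) (xor-cancelʳ a (allTrue w)))
            (dec-inc w)

inc-dec : (w : Word k) → inc (dec w) ≡ w
inc-dec []      = refl
inc-dec (a ∷ w) =
  cong₂ _∷_ (trans (cong ((a xor allFalse w) xor_) (allTrue-dec w)) (xor-cancelʳ a (allFalse w)))
            (inc-dec w)

odometer : ∀ N → Aut N
odometer N = record
  { σ = λ _ → dec ; σ⁻¹ = λ _ → inc
  ; σ⁻¹σ = λ _ → inc-dec ; σσ⁻¹ = λ _ → dec-inc
  ; σ-edge = λ _ a w → refl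
  }

allTrue-∷ʳ-true : (w : Word k) → allTrue (w ∷ʳ true) ≡ allTrue w
allTrue-∷ʳ-true []      = refl
allTrue-∷ʳ-true (a ∷ w) = cong (a ∧_) (allTrue-∷ʳ-true w)

allTrue-∷ʳ-false : (w : Word k) → allTrue (w ∷ʳ false) ≡ false
allTrue-∷ʳ-false []      = refl
allTrue-∷ʳ-false (a ∷ w) = trans (cong (a ∧_) (allTrue-∷ʳ-false w)) (∧-zeroʳ a)

inc-∷ʳ-true : (w : Word k) → inc (w ∷ʳ true) ≡ inc w ∷ʳ false
inc-∷ʳ-true []      = refl
inc-∷ʳ-true (a ∷ w) = cong₂ _∷_ (cong (a xor_) (allTrue-∷ʳ-true w)) (inc-∷ʳ-true w)

inc-∷ʳ-false : (w : Word k) → inc (w ∷ʳ false) ≡ w ∷ʳ true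
inc-∷ʳ-false []      = refl
inc-∷ʳ-false (a ∷ w) =
  cong₂ _∷_ (trans (cong (a xor_) (allTrue-∷ʳ-false w)) (xor-identityʳ a)) (inc-∷ʳ-false w)

inc²-∷ʳ : (w : Word k) (b : Bool) → inc (inc (w ∷ʳ b)) ≡ inc w ∷ʳ b
inc²-∷ʳ w true  = trans (cong inc (inc-∷ʳ-true w)) (inc-∷ʳ-false (inc w))
inc²-∷ʳ w false = trans (cong inc (inc-∷ʳ-false w)) (inc-∷ʳ-true w)

fold-natural : ∀ {A B : Set} (φ : A → B) {h : A → A} {g : B → B} →
               (∀ x → g (φ x) ≡ φ (h x)) → ∀ m x → fold (φ x) g m ≡ φ (fold x h m)
fold-natural φ comm zero    x = refl
fold-natural φ {h} {g} comm (suc m) x =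
  trans (cong g (fold-natural φ comm m x)) (comm (fold x h m))

inc^2^n : ∀ n a (w : Word n) → fold (a ∷ w) inc (2 ^ n) ≡ not a ∷ w
inc^2^n zero    a [] = cong (_∷ []) (xor-comm a true)
inc^2^n (suc n) a w with initLast w
... | w′ , b , refl = begin
  fold z inc (2 * 2 ^ n)              ≡⟨ cong (fold z inc) (*-comm 2 (2 ^ n)) ⟩
  fold z inc (2 ^ n * 2)              ≡⟨ fold-* z inc (2 ^ n) ⟩
  fold z (fold id (inc ∘_) 2) (2 ^ n) ≡⟨ fold-natural (_∷ʳ b) (λ x → inc²-∷ʳ x b) (2 ^ n) (a ∷ w′) ⟩
  fold (a ∷ w′) inc (2 ^ n) ∷ʳ b      ≡⟨ cong (_∷ʳ b) (inc^2^n n a w′) ⟩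
  (not a ∷ w′) ∷ʳ b                   ∎
  where
  z = (a ∷ w′) ∷ʳ b

Δinc^m∈AugPow : ∀ {n} m (u : V (suc n)) → AugPow (suc n) m (fold u (Δ inc) m)
Δinc^m∈AugPow zero    u = base u
Δinc^m∈AugPow (suc m) u = gen (odometer _) (Δinc^m∈AugPow m u)

Δinc^2^n-yBranch : ∀ n (v : V n) → fold (yBranch v) (Δ inc) (2 ^ n) ≗ s v
Δinc^2^n-yBranch n v (a ∷ w) = begin
  fold u (Δ inc) (2 ^ n) (a ∷ w)             ≡⟨ Δ^2^ inc n u (a ∷ w) ⟩
  u (fold (a ∷ w) inc (2 ^ n)) xor u (a ∷ w) ≡⟨ cong (λ z → u z xor u (a ∷ w)) (inc^2^n n a w) ⟩
  u (not a ∷ w) xor u (a ∷ w)                ≡⟨ flip a ⟩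
  v w                                        ∎
  where
  u = yBranch v
  flip : ∀ a → u (not a ∷ w) xor u (a ∷ w) ≡ v w
  flip false = xor-identityʳ (v w)
  flip true  = refl

Im-s⇒AugPow : ∀ {n} (u : V (suc n)) → Im-s u → AugPow (suc n) (2 ^ n) u
Im-s⇒AugPow {n} u (v , sv≗u) =
  resp (λ w → trans (Δinc^2^n-yBranch n v w) (sv≗u w)) (Δinc^m∈AugPow (2 ^ n) (yBranch v))

AugPow⇒Im-s : ∀ {n} (u : V (suc n)) → AugPow (suc n) (2 ^ n) u → Im-s u
AugPow⇒Im-s {n} u d = ker-f⊆Im-s u (AugPowOf-vanishes n (n≤1+n n) 0 f[u]∈I^2^n)
  where
  f[u]∈I^2^n : AugPowOf (n≤1+n n) U (2 ^ n + 0) (f u)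
  f[u]∈I^2^n = subst (λ m → AugPowOf (n≤1+n n) U m (f u)) (sym (+-identityʳ (2 ^ n)))
                     (f-AugPowOf (AugPow⇒AugPowOf d))

proposition6p2 : (n : ℕ) →
    ((u v : V n) → s (u ⊕ v) ≗ s u ⊕ s v) ×
    ((u v : V (suc n)) → f (u ⊕ v) ≗ f u ⊕ f v) ×
    ((g : Aut (suc n)) (v : V n) → s (g ·low v) ≗ g ·top s v) ×
    ((g : Aut (suc n)) (u : V (suc n)) → f (g ·top u) ≗ g ·low f u) ×
    ((v : V n) → s v ≗ 0V → v ≗ 0V) ×
    ((v : V n) → f (s v) ≗ 0V) ×
    ((u : V (suc n)) → f u ≗ 0V → ∃ λ (v : V n) → s v ≗ u) ×
    ((v : V n) → ∃ λ (u : V (suc n)) → f u ≗ v) ×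
    ((u : V (suc n)) → (∃ λ (v : V n) → s v ≗ u) ⇔ AugPow (suc n) (2 ^ n) u)
proposition6p2 n =
  s-⊕ , f-⊕ , (λ g → s-act g ≤-refl) , (λ g → f-act g ≤-refl) ,
  s-injective , f∘s≗0 , ker-f⊆Im-s , (λ v → yBranch v , f-yBranch v) ,
  λ u → mk⇔ (Im-s⇒AugPow u) (AugPow⇒Im-s u)
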